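{- Let $\Gamma=\Gamma_1\sqcup\Gamma_2$ and $\Lambda=\Lambda_1\sqcup\Lambda_2$ be connected bipartite graphs (with the displayed bipartitions, each having at least one edge). Then $\Gamma\times\Lambda$ is the disjoint union of two connected components, the first with vertex set $(\Gamma_1\times\Lambda_1)\cup(\Gamma_2\times\Lambda_2)$ and the second with vertex set $(\Gamma_1\times\Lambda_2)\cup(\Gamma_2\times\Lambda_1)$, and the $i$-th component is $1/\mu_i$-RA with $\mu_i=\gcd(\delta_i,\kappa_i)$, where \[\delta_i=\gcd\{\deg(v)\deg(\lambda)-1 : v\in\Gamma_a,\ \lambda\in\Lambda_b,\ a\in\{1,2\}\},\] \[\kappa_i=\gcd\{|N(u)\cap N(v)|\cdot|N(\lambda_1)\cap N(\lambda_2)| : u,v\in\Gamma_a,\ \lambda_1,\lambda_2\in\Lambda_b,\ a\in\{1,2\},\ (u,\lambda_1)\neq(v,\lambda_2)\},\] with $b=a$ if $i=1$ and $b=3-a$ if $i=2$.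
   Context: All graphs are finite and simple. The tensor product $\Gamma\times\Lambda$ has vertex set $V(\Gamma)\times V(\Lambda)$, with $(u_1,u_2)$ adjacent to $(v_1,v_2)$ iff $u_1$ is adjacent to $v_1$ and $u_2$ is adjacent to $v_2$. $N(v)$ is the (open) neighbourhood of $v$, $N[v]=N(v)\cup\{v\}$, $\deg(v)=|N(v)|$; for a vertex set $S$, $\vec S$ is its $0/1$ indicator vector. The RA matrix $C_\Delta$ of a graph $\Delta$ on $m$ vertices has $m$ columns and rows $\vec{N[v]}$ for all vertices $v$ together with $\overrightarrow{N[u]\cap N[v]}$ for all pairs $u,v$. For $k\ge1$, $\Delta$ is $1/k$-RA if for every ordering of the columns of $C_\Delta$, the diagonal of the Hermite normal form of $C_\Delta$ is $(1,\dots,1,k)$ ($m-1$ ones). -}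

module Defs where

open import Data.Bool using (Bool; true; false; if_then_else_; _∧_; _∨_; not)
open import Data.Nat using (ℕ; zero; suc; _*_; _∸_)
import Data.Nat as ℕ
open import Data.Nat.GCD using (gcd)
open import Data.Fin using (Fin; toℕ; _≟_)
import Data.Bool as 𝔹
open import Data.Integer as ℤ using (ℤ; +_; _+_; _-_)
open import Data.Product using (Σ; _×_; ∃; ∃-syntax; _,_)
open import Data.Sum using (_⊎_; inj₁; inj₂)
open import Relation.Binary.PropositionalEquality using (_≡_; _≢_)
open import Relation.Nullary.Decidable using (⌊_⌋)
open import Relation.Binary.Construct.Closure.ReflexiveTransitive using (Star)

record Graph (n : ℕ) : Set where
  field
    adj    : Fin n → Fin n → Bool
    sym    : ∀ u v → adj u v ≡ adj v u
    irrefl : ∀ v → adj v v ≡ false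
open Graph public

Adj : ∀ {n} → Graph n → Fin n → Fin n → Set
Adj G u v = adj G u v ≡ true

Connected : ∀ {n} → Graph n → Set
Connected G = ∀ u v → Star (Adj G) u v

HasEdge : ∀ {n} → Graph n → Set
HasEdge G = ∃[ u ] ∃[ v ] Adj G u v

-- side v = false : v ∈ part 1 ;  side v = true : v ∈ part 2
-- every edge joins the two parts
IsBipartition : ∀ {n} → Graph n → (Fin n → Bool) → Set
IsBipartition G side = ∀ u v → Adj G u v → side u ≢ side v

count : (n : ℕ) → (Fin n → Bool) → ℕ
count zero    f = 0
count (suc n) f = (if f Fin.zero then 1 else 0) ℕ.+ count n (λ i → f (Fin.suc i))
  where import Data.Fin as Fin

-- gcd of f 0, ..., f (n-1)   (gcd of the empty family is 0)
gcdAll : (n : ℕ) → (Fin n → ℕ) → ℕ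
gcdAll zero    f = 0
gcdAll (suc n) f = gcd (f Fin.zero) (gcdAll n (λ i → f (Fin.suc i)))
  where import Data.Fin as Fin

deg : ∀ {n} → Graph n → Fin n → ℕ
deg {n} G v = count n (adj G v)

common : ∀ {n} → Graph n → Fin n → Fin n → ℕ
common {n} G u v = count n (λ w → adj G u w ∧ adj G v w)

tensorAdj : ∀ {n m} → Graph n → Graph m → Fin n × Fin m → Fin n × Fin m → Bool
tensorAdj Γ Λ (u₁ , u₂) (v₁ , v₂) = adj Γ u₁ v₁ ∧ adj Λ u₂ v₂

IsConnectedComponent : {V : Set} → (V → V → Bool) → (V → Bool) → Set
IsConnectedComponent {V} adjV S =
  (∃[ x ] S x ≡ true)
  × (∀ x y → S x ≡ true → adjV x y ≡ true → S y ≡ true)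
  × (∀ x y → S x ≡ true → S y ≡ true →
       Star (λ a b → adjV a b ≡ true × S b ≡ true) x y)

data InSpan {I : Set} {k : ℕ} (R : I → Fin k → ℤ) : (Fin k → ℤ) → Set where
  span-zero : InSpan R (λ _ → + 0)
  span-add  : ∀ {v} → InSpan R v → (i : I) → InSpan R (λ c → v c + R i c)
  span-sub  : ∀ {v} → InSpan R v → (i : I) → InSpan R (λ c → v c - R i c)
  span-ext  : ∀ {v w} → InSpan R v → (∀ c → v c ≡ w c) → InSpan R w

IsHNF : ∀ {k} → (Fin k → Fin k → ℤ) → Set
IsHNF {k} H =
  (∀ i j → toℕ j ℕ.< toℕ i → H i j ≡ + 0)
  × (∀ i → + 0 ℤ.≤ H i i)
  × (∀ i j → toℕ i ℕ.< toℕ j → + 0 ℤ.< H j j → (+ 0 ℤ.≤ H i j) × (H i j ℤ.< H j j))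

-- The (top k × k block of the) Hermite normal form of the matrix with rows C
-- has diagonal d.
HNFDiagonalIs : ∀ {I : Set} {k} → (I → Fin k → ℤ) → (Fin k → ℤ) → Set
HNFDiagonalIs {I} {k} C d =
  Σ (Fin k → Fin k → ℤ) λ H →
    IsHNF H
    × (∀ i → InSpan C (H i))
    × (∀ r → InSpan H (C r))
    × (∀ j → H j j ≡ d j)

diagTarget : (k μ : ℕ) → Fin k → ℤ
diagTarget k μ j = if ⌊ suc (toℕ j) ℕ.≟ k ⌋ then + μ else + 1

b2z : Bool → ℤ
b2z true  = + 1
b2z false = + 0

closedNbhd : {V : Set} → (V → V → Bool) → ∀ {k} → (Fin k → V) → Fin k → Fin k → Bool
closedNbhd adjV e i c = ⌊ i ≟ c ⌋ ∨ adjV (e i) (e c)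

-- rows: N[v] for every vertex v, and N[u] ∩ N[v] for every pair (u , v)
RAMatrix : {V : Set} → (V → V → Bool) → ∀ {k} → (Fin k → V) →
           (Fin k ⊎ (Fin k × Fin k)) → Fin k → ℤ
RAMatrix adjV e (inj₁ i)       c = b2z (closedNbhd adjV e i c)
RAMatrix adjV e (inj₂ (i , j)) c = b2z (closedNbhd adjV e i c ∧ closedNbhd adjV e j c)

-- The subgraph induced on S is 1/μ-RA: for every ordering e of its vertices
-- (a bijection Fin k → S) the HNF of its RA matrix has diagonal (1,...,1,μ).
IsRA : {V : Set} → (V → V → Bool) → (V → Bool) → ℕ → Set
IsRA {V} adjV S μ =
  ∀ k (e : Fin k → V) →
    (∀ i j → e i ≡ e j → i ≡ j) →
    (∀ i → S (e i) ≡ true) →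
    (∀ v → S v ≡ true → ∃[ i ] e i ≡ v) →
    HNFDiagonalIs (RAMatrix adjV e) (diagTarget k μ)

comp₁ : ∀ {n m} → (Fin n → Bool) → (Fin m → Bool) → Fin n × Fin m → Bool
comp₁ sΓ sΛ (g , l) = (not (sΓ g) ∧ not (sΛ l)) ∨ (sΓ g ∧ sΛ l)

comp₂ : ∀ {n m} → (Fin n → Bool) → (Fin m → Bool) → Fin n × Fin m → Bool
comp₂ sΓ sΛ (g , l) = (not (sΓ g) ∧ sΛ l) ∨ (sΓ g ∧ not (sΛ l))

data Comp : Set where
  c₁ c₂ : Comp

-- b = a for i = 1, b = 3 - a for i = 2 (parts encoded as Bool)
bPart : Comp → Bool → Bool
bPart c₁ a = a
bPart c₂ a = not a

eqB : Bool → Bool → Bool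
eqB x y = ⌊ x 𝔹.≟ y ⌋

δ : ∀ {n m} → Graph n → (Fin n → Bool) → Graph m → (Fin m → Bool) → Comp → ℕ
δ {n} {m} Γ sΓ Λ sΛ c =
  gcdAll n λ v → gcdAll m λ l →
    if eqB (sΛ l) (bPart c (sΓ v)) then deg Γ v * deg Λ l ∸ 1 else 0

κ : ∀ {n m} → Graph n → (Fin n → Bool) → Graph m → (Fin m → Bool) → Comp → ℕ
κ {n} {m} Γ sΓ Λ sΛ c =
  gcdAll n λ u → gcdAll n λ v → gcdAll m λ l₁ → gcdAll m λ l₂ →
    if eqB (sΓ u) (sΓ v) ∧ eqB (sΛ l₁) (bPart c (sΓ u)) ∧ eqB (sΛ l₂) (bPart c (sΓ u))
       ∧ not (⌊ u ≟ v ⌋ ∧ ⌊ l₁ ≟ l₂ ⌋)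
    then common Γ u v * common Λ l₁ l₂ else 0

μ : ∀ {n m} → Graph n → (Fin n → Bool) → Graph m → (Fin m → Bool) → Comp → ℕ
μ Γ sΓ Λ sΛ c = gcd (δ Γ sΓ Λ sΛ c) (κ Γ sΓ Λ sΛ c)

module Submission where

-- Order the vertices of a component and give each the sign σ = ±1 of its Γ-side. The RA rows
-- N[u] ∩ N[v] for adjacent u, v are e_u + e_v, so walks to the last vertex ℓ put every
-- e_i − σ_i σ_ℓ e_ℓ into the row lattice, and modulo these vectors a row reduces to its signed sum
-- Σ σ_c x_c times e_ℓ. Degrees and common neighbourhoods multiply in a tensor product, so the signed
-- sums of the rows are 0 or ± the generators of δ and κ. Hence the row lattice is
-- {x | μ divides Σ σ_c x_c}, whose Hermite normal form has the rows e_i + t_i e_ℓ with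
-- t_i ≡ −σ_i σ_ℓ (mod μ) and μ e_ℓ. The components are found by zipping walks of equal parity
-- in Γ and Λ.

open import Defs hiding (sym)
open import Data.Bool using (Bool; true; false; if_then_else_; _∧_; not; _xor_)
import Data.Bool as 𝔹
open import Data.Bool.Properties
  using (not-involutive; not-injective; not-¬; ¬-not; ∧-idem; ∧-identityʳ; not-distribˡ-xor; not-distribʳ-xor)
open import Data.Empty using (⊥-elim)
open import Data.Fin using (Fin; zero; suc; toℕ; fromℕ; _≟_)
import Data.Fin.Properties as Finₚ
open import Data.Integer as ℤ using (ℤ; +_; -[1+_]; _+_; _-_; _*_; -_; ∣_∣; +≤+; +<+)
import Data.Integer.Properties as ℤₚ
open import Data.Integer.Divisibility.Signed as ℤ∣ using (divides)
open import Data.Integer.Tactic.RingSolver using (solve-∀)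
open import Data.Nat as ℕ using (ℕ; zero; suc; _∸_; z≤n; s≤s)
import Data.Nat.Properties as ℕₚ
open import Data.Nat.Divisibility as ℕ∣ using (∣-trans)
open import Data.Nat.GCD using (gcd; gcd[m,n]∣m; gcd[m,n]∣n; gcd-GCD; module Bézout)
open import Data.Product using (∃-syntax; _×_; _,_; proj₁; proj₂)
open import Data.Sum using (_⊎_; inj₁; inj₂)
open import Relation.Binary.PropositionalEquality
open import Relation.Binary.Construct.Closure.ReflexiveTransitive as Star using (Star; ε; _◅_)
open import Relation.Nullary.Decidable using (⌊_⌋; yes; no)
open import Function using (_∘_)

import Algebra.Properties.Semiring.Sum as SemiringSum

module ℤΣ = SemiringSum ℤₚ.+-*-semiring

-- Integer row lattices

module _ {I : Set} {k : ℕ} {R : I → Fin k → ℤ} where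

  inSpan-row : ∀ i → InSpan R (R i)
  inSpan-row i = span-ext (span-add span-zero i) (λ c → ℤₚ.+-identityˡ (R i c))

  inSpan-+ : ∀ {v w} → InSpan R v → InSpan R w → InSpan R (λ c → v c + w c)
  inSpan-+ {v} sv span-zero = span-ext sv (λ c → sym (ℤₚ.+-identityʳ (v c)))
  inSpan-+ {v} sv (span-add {w} sw i) =
    span-ext (span-add (inSpan-+ sv sw) i) (λ c → ℤₚ.+-assoc (v c) (w c) (R i c))
  inSpan-+ {v} sv (span-sub {w} sw i) =
    span-ext (span-sub (inSpan-+ sv sw) i) (λ c → ℤₚ.+-assoc (v c) (w c) (- R i c))
  inSpan-+ {v} sv (span-ext sw w≗w′) = span-ext (inSpan-+ sv sw) (λ c → cong (λ z → v c + z) (w≗w′ c))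

  inSpan-neg : ∀ {v} → InSpan R v → InSpan R (λ c → - v c)
  inSpan-neg span-zero = span-zero
  inSpan-neg (span-add {w} sw i) =
    span-ext (span-sub (inSpan-neg sw) i) (λ c → sym (ℤₚ.neg-distrib-+ (w c) (R i c)))
  inSpan-neg (span-sub {w} sw i) =
    span-ext (span-add (inSpan-neg sw) i) (λ c → lemma (w c) (R i c))
    where lemma : ∀ a r → - a + r ≡ - (a - r)
          lemma = solve-∀
  inSpan-neg (span-ext sw w≗w′) = span-ext (inSpan-neg sw) (λ c → cong -_ (w≗w′ c))

  inSpan-- : ∀ {v w} → InSpan R v → InSpan R w → InSpan R (λ c → v c - w c)
  inSpan-- sv sw = inSpan-+ sv (inSpan-neg sw)

  inSpan-*ℕ : ∀ {v} n → InSpan R v → InSpan R (λ c → + n * v c)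
  inSpan-*ℕ {v} zero    sv = span-ext span-zero (λ c → sym (ℤₚ.*-zeroˡ (v c)))
  inSpan-*ℕ {v} (suc n) sv = span-ext (inSpan-+ sv (inSpan-*ℕ n sv)) (λ c → sym (ℤₚ.suc-* (+ n) (v c)))

  inSpan-* : ∀ {v} z → InSpan R v → InSpan R (λ c → z * v c)
  inSpan-* (+ n)      sv = inSpan-*ℕ n sv
  inSpan-* {v} -[1+ n ] sv =
    span-ext (inSpan-neg (inSpan-*ℕ (suc n) sv)) (λ c → ℤₚ.neg-distribˡ-* (+ suc n) (v c))

  inSpan-∑ : ∀ {n} (a : Fin n → ℤ) {v : Fin n → Fin k → ℤ} → (∀ i → InSpan R (v i)) →
             InSpan R (λ c → ℤΣ.sum (λ i → a i * v i c))
  inSpan-∑ {zero}  a sv = span-zero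
  inSpan-∑ {suc n} a sv = inSpan-+ (inSpan-* (a zero) (sv zero)) (inSpan-∑ (a ∘ suc) (sv ∘ suc))

module _ {I : Set} {k : ℕ} {R : I → Fin k → ℤ} (w : Fin k → ℤ) where

  private
    Multiple : ℕ → Set
    Multiple a = InSpan R (λ c → + a * w c)

    combination : ∀ {d a b} x y → d ℕ.+ y ℕ.* b ≡ x ℕ.* a →
                  Multiple a → Multiple b → Multiple d
    combination {d} {a} {b} x y eq sa sb =
      span-ext (inSpan-- (inSpan-* (+ x) sa) (inSpan-* (+ y) sb)) pointwise
      where
      eqℤ : + x * + a ≡ + d + + y * + b
      eqℤ = begin
        + x * + a        ≡⟨ ℤₚ.pos-* x a ⟨
        + (x ℕ.* a)      ≡⟨ cong +_ eq ⟨
        + (d ℕ.+ y ℕ.* b) ≡⟨ ℤₚ.pos-+ d (y ℕ.* b) ⟩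
        + d + + (y ℕ.* b) ≡⟨ cong (λ z → + d + z) (ℤₚ.pos-* y b) ⟩
        + d + + y * + b  ∎
        where open ≡-Reasoning
      regroup : ∀ x a y b e → x * (a * e) - y * (b * e) ≡ (x * a - y * b) * e
      regroup = solve-∀
      cancel : ∀ d q e → (d + q - q) * e ≡ d * e
      cancel = solve-∀
      pointwise : ∀ c → + x * (+ a * w c) - + y * (+ b * w c) ≡ + d * w c
      pointwise c = trans (regroup (+ x) (+ a) (+ y) (+ b) (w c))
                    (trans (cong (λ z → (z - + y * + b) * w c) eqℤ) (cancel (+ d) (+ y * + b) (w c)))

  inSpan-gcd : ∀ {a b} → InSpan R (λ c → + a * w c) → InSpan R (λ c → + b * w c) →
               InSpan R (λ c → + gcd a b * w c)
  inSpan-gcd {a} {b} sa sb with Bézout.identity (gcd-GCD a b)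
  ... | Bézout.+- x y eq = combination x y eq sa sb
  ... | Bézout.-+ x y eq = combination y x eq sb sa

  inSpan-gcdAll : ∀ n (f : Fin n → ℕ) → (∀ i → InSpan R (λ c → + f i * w c)) →
                  InSpan R (λ c → + gcdAll n f * w c)
  inSpan-gcdAll zero    f sf = span-ext span-zero (λ c → sym (ℤₚ.*-zeroˡ (w c)))
  inSpan-gcdAll (suc n) f sf = inSpan-gcd {f zero} (sf zero) (inSpan-gcdAll n (f ∘ suc) (sf ∘ suc))

  inSpan-∣∣ : ∀ z → InSpan R (λ c → z * w c) → InSpan R (λ c → + ∣ z ∣ * w c)
  inSpan-∣∣ (+ n)      s = s
  inSpan-∣∣ -[1+ n ] s = span-ext (inSpan-neg s) (λ c → ℤₚ.neg-distribˡ-* -[1+ n ] (w c))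

  inSpan-∣ : ∀ {a z} → a ℤ∣.∣ z → InSpan R (λ c → a * w c) → InSpan R (λ c → z * w c)
  inSpan-∣ {a} (divides q refl) s = span-ext (inSpan-* q s) (λ c → sym (ℤₚ.*-assoc q a (w c)))

gcdAll∣ : ∀ n (f : Fin n → ℕ) i → gcdAll n f ℕ∣.∣ f i
gcdAll∣ (suc n) f zero    = gcd[m,n]∣m (f zero) (gcdAll n (f ∘ suc))
gcdAll∣ (suc n) f (suc i) = ∣-trans (gcd[m,n]∣n (f zero) (gcdAll n (f ∘ suc))) (gcdAll∣ n (f ∘ suc) i)

-- Signed sums and the Hermite normal form

sgn : Bool → ℤ
sgn false = + 1
sgn true  = -[1+ 0 ]

sgn*sgn : ∀ b → sgn b * sgn b ≡ + 1
sgn*sgn false = refl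
sgn*sgn true  = refl

∣sgn∣ : ∀ b → ∣ sgn b ∣ ≡ 1
∣sgn∣ false = refl
∣sgn∣ true  = refl

sgn-not : ∀ b → sgn (not b) ≡ - sgn b
sgn-not false = refl
sgn-not true  = refl

basis : ∀ {k} → Fin k → Fin k → ℤ
basis i c = b2z ⌊ i ≟ c ⌋

⌊≟⌋-refl : ∀ {k} (i : Fin k) → ⌊ i ≟ i ⌋ ≡ true
⌊≟⌋-refl i with i ≟ i
... | yes _  = refl
... | no i≢i = ⊥-elim (i≢i refl)

≢⇒≟×≟-false : ∀ {n m} {g g′ : Fin n} {l l′ : Fin m} → (g , l) ≢ (g′ , l′) →
               not (⌊ g ≟ g′ ⌋ ∧ ⌊ l ≟ l′ ⌋) ≡ true
≢⇒≟×≟-false {g = g} {g′} {l} {l′} x≢y with g ≟ g′ | l ≟ l′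
... | yes refl | yes refl = ⊥-elim (x≢y refl)
... | yes _    | no _     = refl
... | no _     | _        = refl

basis-diag : ∀ {k} (i : Fin k) → basis i i ≡ + 1
basis-diag i = cong b2z (⌊≟⌋-refl i)

basis-≢ : ∀ {k} {i c : Fin k} → i ≢ c → basis i c ≡ + 0
basis-≢ {i = i} {c} i≢c with i ≟ c
... | yes i≡c = ⊥-elim (i≢c i≡c)
... | no _    = refl

basis-sym : ∀ {k} (i c : Fin k) → basis i c ≡ basis c i
basis-sym i c with i ≟ c | c ≟ i
... | yes _   | yes _   = refl
... | no _    | no _    = refl
... | yes i≡c | no c≢i  = ⊥-elim (c≢i (sym i≡c))
... | no i≢c  | yes c≡i = ⊥-elim (i≢c (sym c≡i))

∑-*basis : ∀ {k} (f : Fin k → ℤ) c → ℤΣ.sum (λ i → f i * basis i c) ≡ f c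
∑-*basis {suc k} f zero = begin
  f zero * + 1 + ℤΣ.sum (λ i → f (suc i) * + 0) ≡⟨ cong₂ _+_ (ℤₚ.*-identityʳ (f zero))
                                                    (ℤΣ.sum-cong-≗ {k} (ℤₚ.*-zeroʳ ∘ f ∘ suc)) ⟩
  f zero + ℤΣ.sum {k} (λ _ → + 0)                 ≡⟨ cong (λ z → f zero + z) (ℤΣ.sum-replicate-zero k) ⟩
  f zero + + 0                                  ≡⟨ ℤₚ.+-identityʳ (f zero) ⟩
  f zero                                        ∎
  where open ≡-Reasoning
∑-*basis {suc k} f (suc c) = begin
  f zero * + 0 + ℤΣ.sum (λ i → f (suc i) * basis (suc i) (suc c))
    ≡⟨ cong₂ _+_ (ℤₚ.*-zeroʳ (f zero)) (ℤΣ.sum-cong-≗ (λ i → cong (f (suc i) *_) (basis-suc i c))) ⟩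
  + 0 + ℤΣ.sum (λ i → f (suc i) * basis i c)
    ≡⟨ ℤₚ.+-identityˡ _ ⟩
  ℤΣ.sum (λ i → f (suc i) * basis i c)
    ≡⟨ ∑-*basis (f ∘ suc) c ⟩
  f (suc c) ∎
  where
  open ≡-Reasoning
  basis-suc : ∀ {k} (i c : Fin k) → basis (suc i) (suc c) ≡ basis i c
  basis-suc i c with i ≟ c
  ... | yes _ = refl
  ... | no _  = refl

module SignedSum {k} (side : Fin k → Bool) where

  σ : Fin k → ℤ
  σ i = sgn (side i)

  signedSum : (Fin k → ℤ) → ℤ
  signedSum x = ℤΣ.sum (λ c → σ c * x c)

  signedSum-basis : ∀ i → signedSum (basis i) ≡ σ i
  signedSum-basis i = trans (ℤΣ.sum-cong-≗ (λ c → cong (σ c *_) (basis-sym i c))) (∑-*basis σ i)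

  signedSum-+ : ∀ x y → signedSum (λ d → x d + y d) ≡ signedSum x + signedSum y
  signedSum-+ x y = trans (ℤΣ.sum-cong-≗ (λ c → ℤₚ.*-distribˡ-+ (σ c) (x c) (y c)))
                          (ℤΣ.∑-distrib-+ (λ c → σ c * x c) (λ c → σ c * y c))

  signedSum-* : ∀ a x → signedSum (λ d → a * x d) ≡ a * signedSum x
  signedSum-* a x = trans (ℤΣ.sum-cong-≗ (λ c → swap (σ c) a (x c)))
                          (sym (ℤΣ.*-distribˡ-sum a (λ c → σ c * x c)))
    where swap : ∀ s a x → s * (a * x) ≡ a * (s * x)
          swap = solve-∀

  module _ (ℓ : Fin k) where

    kernelVector : Fin k → Fin k → ℤ
    kernelVector i d = basis i d - σ i * σ ℓ * basis ℓ d

    decompose : ∀ x d →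
      ℤΣ.sum (λ c → x c * kernelVector c d) + σ ℓ * signedSum x * basis ℓ d ≡ x d
    decompose x d = begin
      ℤΣ.sum (λ c → x c * kernelVector c d) + σℓφ
        ≡⟨ cong (_+ σℓφ) (ℤΣ.sum-cong-≗ (λ c → distribute (x c) (basis c d) (σ c) (σ ℓ) (basis ℓ d))) ⟩
      ℤΣ.sum (λ c → x c * basis c d + a * (σ c * x c)) + σℓφ
        ≡⟨ cong (_+ σℓφ) (ℤΣ.∑-distrib-+ (λ c → x c * basis c d) (λ c → a * (σ c * x c))) ⟩
      ℤΣ.sum (λ c → x c * basis c d) + ℤΣ.sum (λ c → a * (σ c * x c)) + σℓφ
        ≡⟨ cong₂ (λ p q → p + q + σℓφ) (∑-*basis x d) (sym (ℤΣ.*-distribˡ-sum a (λ c → σ c * x c))) ⟩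
      x d + a * signedSum x + σℓφ
        ≡⟨ cancel (x d) (σ ℓ) (basis ℓ d) (signedSum x) ⟩
      x d ∎
      where
      open ≡-Reasoning
      a σℓφ : ℤ
      a = - (σ ℓ * basis ℓ d)
      σℓφ = σ ℓ * signedSum x * basis ℓ d
      distribute : ∀ y e s t f → y * (e - s * t * f) ≡ y * e + - (t * f) * (s * y)
      distribute = solve-∀
      cancel : ∀ y t f p → y + - (t * f) * p + t * p * f ≡ y
      cancel = solve-∀

    module _ {I : Set} (R : I → Fin k → ℤ) (kernel⊆R : ∀ i → InSpan R (kernelVector i)) where

      private
        inSpan-σℓφ*basis : ∀ {x} → InSpan R x → InSpan R (λ d → σ ℓ * signedSum x * basis ℓ d)
        inSpan-σℓφ*basis {x} sx = span-ext (inSpan-- sx (inSpan-∑ x kernel⊆R)) isolate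
          where
          cancel : ∀ a b → a + b - a ≡ b
          cancel = solve-∀
          isolate : ∀ d → x d - ℤΣ.sum (λ c → x c * kernelVector c d) ≡ σ ℓ * signedSum x * basis ℓ d
          isolate d = trans (cong (_- ℤΣ.sum (λ c → x c * kernelVector c d)) (sym (decompose x d)))
                            (cancel (ℤΣ.sum (λ c → x c * kernelVector c d)) _)

      inSpan-signedSum*basis : ∀ {x} → InSpan R x → InSpan R (λ d → signedSum x * basis ℓ d)
      inSpan-signedSum*basis {x} sx = span-ext (inSpan-* (σ ℓ) (inSpan-σℓφ*basis sx)) unsign
        where
        regroup : ∀ s p e → s * (s * p * e) ≡ s * s * (p * e)
        regroup = solve-∀
        unsign : ∀ d → σ ℓ * (σ ℓ * signedSum x * basis ℓ d) ≡ signedSum x * basis ℓ d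
        unsign d = trans (regroup (σ ℓ) (signedSum x) (basis ℓ d))
                         (trans (cong (_* (signedSum x * basis ℓ d)) (sgn*sgn (side ℓ))) (ℤₚ.*-identityˡ _))

      inSpan-of-divisible : ∀ {μ} → InSpan R (λ d → + μ * basis ℓ d) →
                            ∀ x → + μ ℤ∣.∣ signedSum x → InSpan R x
      inSpan-of-divisible μℓ x μ∣φ =
        span-ext (inSpan-+ (inSpan-∑ x kernel⊆R) (inSpan-∣ (basis ℓ) (ℤ∣.∣n⇒∣m*n (σ ℓ) μ∣φ) μℓ))
                 (decompose x)

module LastColumnHermite (K μ : ℕ) (t : Fin (suc K) → ℤ) where

  ℓ : Fin (suc K)
  ℓ = fromℕ K

  <⇒≢ℓ : ∀ {i j : Fin (suc K)} → toℕ j ℕ.< toℕ i → j ≢ ℓ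
  <⇒≢ℓ {i} j<i refl =
    ℕₚ.<⇒≱ j<i (subst (toℕ i ℕ.≤_) (sym (Finₚ.toℕ-fromℕ K)) (Finₚ.toℕ≤pred[n] i))

  >⇒≢ : ∀ {i j : Fin (suc K)} → toℕ j ℕ.< toℕ i → i ≢ j
  >⇒≢ j<i refl = ℕₚ.<-irrefl refl j<i

  -- With t ℓ = μ − 1 the last row is μ e_ℓ, so one formula covers every row.
  hermite : Fin (suc K) → Fin (suc K) → ℤ
  hermite i d = basis i d + t i * basis ℓ d

  hermite-off : ∀ {i d} → i ≢ d → d ≢ ℓ → hermite i d ≡ + 0
  hermite-off {i} i≢d d≢ℓ
    rewrite basis-≢ i≢d | basis-≢ (d≢ℓ ∘ sym) | ℤₚ.*-zeroʳ (t i) = refl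

  hermite-diag : ∀ {i} → i ≢ ℓ → hermite i i ≡ + 1
  hermite-diag {i} i≢ℓ rewrite basis-diag i | basis-≢ (i≢ℓ ∘ sym) | ℤₚ.*-zeroʳ (t i) = refl

  hermite-lastColumn : ∀ {i} → i ≢ ℓ → hermite i ℓ ≡ t i
  hermite-lastColumn {i} i≢ℓ
    rewrite basis-≢ i≢ℓ | basis-diag ℓ | ℤₚ.*-identityʳ (t i) = ℤₚ.+-identityˡ (t i)

  module _ (tℓ : t ℓ ≡ + μ - + 1) where

    hermite-lastRow : ∀ d → hermite ℓ d ≡ + μ * basis ℓ d
    hermite-lastRow d rewrite tℓ = regroup (+ μ) (basis ℓ d)
      where regroup : ∀ m e → e + (m - + 1) * e ≡ m * e
            regroup = solve-∀

    hermite-pivot : hermite ℓ ℓ ≡ + μ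
    hermite-pivot = trans (hermite-lastRow ℓ) (trans (cong (+ μ *_) (basis-diag ℓ)) (ℤₚ.*-identityʳ (+ μ)))

    hermite-diagTarget : ∀ j → hermite j j ≡ diagTarget (suc K) μ j
    hermite-diagTarget j with j ≟ ℓ | suc (toℕ j) ℕ.≟ suc K
    ... | yes refl | yes _  = hermite-pivot
    ... | yes refl | no j≢K = ⊥-elim (j≢K (cong suc (Finₚ.toℕ-fromℕ K)))
    ... | no j≢ℓ   | yes j≡K =
      ⊥-elim (j≢ℓ (Finₚ.toℕ-injective (trans (ℕₚ.suc-injective j≡K) (sym (Finₚ.toℕ-fromℕ K)))))
    ... | no j≢ℓ   | no _   = hermite-diag j≢ℓ

    hermite-isHNF : (∀ i → .{{ℕ.NonZero μ}} → + 0 ℤ.≤ t i × t i ℤ.< + μ) → IsHNF hermite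
    hermite-isHNF t-reduced = lower , nonnegative , reduced
      where
      lower : ∀ i j → toℕ j ℕ.< toℕ i → hermite i j ≡ + 0
      lower i j j<i = hermite-off (>⇒≢ j<i) (<⇒≢ℓ j<i)

      nonnegative : ∀ i → + 0 ℤ.≤ hermite i i
      nonnegative i with i ≟ ℓ
      ... | yes refl = subst (+ 0 ℤ.≤_) (sym hermite-pivot) (+≤+ z≤n)
      ... | no i≢ℓ   = subst (+ 0 ℤ.≤_) (sym (hermite-diag i≢ℓ)) (+≤+ z≤n)

      reduced : ∀ i j → toℕ i ℕ.< toℕ j → + 0 ℤ.< hermite j j →
                (+ 0 ℤ.≤ hermite i j) × (hermite i j ℤ.< hermite j j)
      reduced i j i<j pivot>0 with j ≟ ℓ
      ... | yes refl rewrite hermite-lastColumn (<⇒≢ℓ i<j) | hermite-pivot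
        with pivot>0
      ...   | +<+ 0<μ = t-reduced i {{ℕ.>-nonZero 0<μ}}
      reduced i j i<j _ | no j≢ℓ
        rewrite hermite-off (>⇒≢ i<j ∘ sym) j≢ℓ | hermite-diag j≢ℓ = +≤+ z≤n , +<+ (s≤s z≤n)

eqB-refl : ∀ x → eqB x x ≡ true
eqB-refl false = refl
eqB-refl true  = refl

eqB-sound : ∀ {x y} → eqB x y ≡ true → x ≡ y
eqB-sound {false} {false} _ = refl
eqB-sound {true}  {true}  _ = refl

eqB-complete : ∀ {x y} → x ≡ y → eqB x y ≡ true
eqB-complete {x} refl = eqB-refl x

-- residue μ (eqB a b) represents -(sgn a * sgn b) modulo μ, in [0, μ) when μ > 0.
residue : ℕ → Bool → ℤ
residue μ       true  = + μ - + 1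
residue 1       false = + 0
residue _       false = + 1

private
  residue-same : ∀ μ → + μ ℤ∣.∣ residue μ true + + 1
  residue-same μ = divides (+ 1) (regroup (+ μ))
    where regroup : ∀ m → m - + 1 + + 1 ≡ + 1 * m
          regroup = solve-∀

  residue-opposite : ∀ μ → + μ ℤ∣.∣ residue μ false + -[1+ 0 ]
  residue-opposite 0             = divides (+ 0) refl
  residue-opposite 1             = divides -[1+ 0 ] refl
  residue-opposite (suc (suc μ)) = divides (+ 0) refl

residue-congruence : ∀ μ a b → + μ ℤ∣.∣ residue μ (eqB a b) + sgn a * sgn b
residue-congruence μ false false = residue-same μ
residue-congruence μ true  true  = residue-same μ
residue-congruence μ false true  = residue-opposite μ
residue-congruence μ true  false = residue-opposite μ

residue-reduced : ∀ μ b → .{{ℕ.NonZero μ}} → + 0 ℤ.≤ residue μ b × residue μ b ℤ.< + μ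
residue-reduced (suc μ)       true  = +≤+ z≤n , +<+ (ℕₚ.n<1+n μ)
residue-reduced 1             false = +≤+ z≤n , +<+ (s≤s z≤n)
residue-reduced (suc (suc μ)) false = +≤+ z≤n , +<+ (s≤s (s≤s z≤n))

module _ {I : Set} {K : ℕ} (C : I → Fin (suc K) → ℤ) (side : Fin (suc K) → Bool) (μ : ℕ) where

  open SignedSum side

  private
    ℓ : Fin (suc K)
    ℓ = fromℕ K

    t : Fin (suc K) → ℤ
    t i = residue μ (eqB (side i) (side ℓ))

    open LastColumnHermite K μ t hiding (ℓ)

    tℓ : t ℓ ≡ + μ - + 1
    tℓ = cong (residue μ) (eqB-refl (side ℓ))

    μ∣hermite : ∀ i → + μ ℤ∣.∣ signedSum (hermite i)
    μ∣hermite i = subst (+ μ ℤ∣.∣_) (sym signedSum-hermite)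
                        (ℤ∣.∣n⇒∣m*n (σ ℓ) (residue-congruence μ (side i) (side ℓ)))
      where
      expand : ∀ s r u → s * (r + u * s) ≡ u * (s * s) + r * s
      expand = solve-∀
      signedSum-hermite : signedSum (hermite i) ≡ σ ℓ * (t i + σ i * σ ℓ)
      signedSum-hermite = begin
        signedSum (hermite i)                   ≡⟨ signedSum-+ (basis i) (λ d → t i * basis ℓ d) ⟩
        signedSum (basis i) + signedSum (λ d → t i * basis ℓ d)
                                                ≡⟨ cong (λ z → signedSum (basis i) + z) (signedSum-* (t i) (basis ℓ)) ⟩
        signedSum (basis i) + t i * signedSum (basis ℓ)
                                                ≡⟨ cong₂ (λ a b → a + t i * b) (signedSum-basis i) (signedSum-basis ℓ) ⟩
        σ i + t i * σ ℓ                         ≡⟨ cong (λ z → z + t i * σ ℓ) (ℤₚ.*-identityʳ (σ i)) ⟨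
        σ i * + 1 + t i * σ ℓ                   ≡⟨ cong (λ z → σ i * z + t i * σ ℓ) (sgn*sgn (side ℓ)) ⟨
        σ i * (σ ℓ * σ ℓ) + t i * σ ℓ           ≡⟨ expand (σ ℓ) (t i) (σ i) ⟨
        σ ℓ * (t i + σ i * σ ℓ)                 ∎
        where open ≡-Reasoning

    kernel⊆hermite : ∀ i → InSpan hermite (kernelVector ℓ i)
    kernel⊆hermite i with residue-congruence μ (side i) (side ℓ)
    ... | divides q t+σσ≡qμ =
      span-ext (inSpan-- (inSpan-row i) (inSpan-* q (inSpan-row ℓ))) pointwise
      where
      regroup : ∀ e t s q m f → e + t * f - q * (m * f) ≡ e - s * f + (t + s - q * m) * f
      regroup = solve-∀
      pointwise : ∀ d → hermite i d - q * hermite ℓ d ≡ kernelVector ℓ i d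
      pointwise d = begin
        hermite i d - q * hermite ℓ d
          ≡⟨ cong (λ z → hermite i d - q * z) (hermite-lastRow tℓ d) ⟩
        basis i d + t i * basis ℓ d - q * (+ μ * basis ℓ d)
          ≡⟨ regroup (basis i d) (t i) (σ i * σ ℓ) q (+ μ) (basis ℓ d) ⟩
        kernelVector ℓ i d + (t i + σ i * σ ℓ - q * + μ) * basis ℓ d
          ≡⟨ cong (λ z → kernelVector ℓ i d + (z - q * + μ) * basis ℓ d) t+σσ≡qμ ⟩
        kernelVector ℓ i d + (q * + μ - q * + μ) * basis ℓ d
          ≡⟨ cong (λ z → kernelVector ℓ i d + z * basis ℓ d) (ℤₚ.+-inverseʳ (q * + μ)) ⟩
        kernelVector ℓ i d + + 0 * basis ℓ d
          ≡⟨ ℤₚ.+-identityʳ (kernelVector ℓ i d) ⟩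
        kernelVector ℓ i d ∎
        where open ≡-Reasoning

  hnfDiagonal-signedSumLattice :
    (∀ r → + μ ℤ∣.∣ signedSum (C r)) →
    (∀ i → InSpan C (kernelVector ℓ i)) →
    InSpan C (λ d → + μ * basis ℓ d) →
    HNFDiagonalIs C (diagTarget (suc K) μ)
  hnfDiagonal-signedSumLattice μ∣C kernel⊆C μℓ∈C =
    hermite ,
    hermite-isHNF tℓ (λ i → residue-reduced μ (eqB (side i) (side ℓ))) ,
    (λ i → inSpan-of-divisible ℓ C kernel⊆C μℓ∈C (hermite i) (μ∣hermite i)) ,
    (λ r → inSpan-of-divisible ℓ hermite kernel⊆hermite μℓ∈hermite (C r) (μ∣C r)) ,
    hermite-diagTarget tℓ
    where
    μℓ∈hermite : InSpan hermite (λ d → + μ * basis ℓ d)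
    μℓ∈hermite = span-ext (inSpan-row ℓ) (hermite-lastRow tℓ)

-- RA rows of a bipartite graph

b2z-∧ : ∀ x y → b2z (x ∧ y) ≡ b2z x * b2z y
b2z-∧ false y = refl
b2z-∧ true  y = sym (ℤₚ.*-identityˡ (b2z y))

module BipartiteRARows {V : Set} (adjV : V → V → Bool) {k} (e : Fin k → V) (side : Fin k → Bool)
  (adj-sym  : ∀ i j → adjV (e i) (e j) ≡ adjV (e j) (e i))
  (adj-flip : ∀ {i j} → adjV (e i) (e j) ≡ true → side j ≡ not (side i)) where

  open SignedSum side

  A : Fin k → Fin k → Bool
  A i c = adjV (e i) (e c)

  row : (Fin k ⊎ (Fin k × Fin k)) → Fin k → ℤ
  row = RAMatrix adjV e

  sameSide⇒nonadjacent : ∀ {i j} → side i ≡ side j → A i j ≡ false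
  sameSide⇒nonadjacent {i} {j} same with A i j in adjacent
  ... | false = refl
  ... | true  = ⊥-elim (not-¬ refl (trans same (adj-flip adjacent)))

  σ-neighbour : ∀ i c → σ c * b2z (A i c) ≡ - σ i * b2z (A i c)
  σ-neighbour i c with A i c in adjacent
  ... | true  = cong (_* + 1) (trans (cong sgn (adj-flip adjacent)) (sgn-not (side i)))
  ... | false = trans (ℤₚ.*-zeroʳ (σ c)) (sym (ℤₚ.*-zeroʳ (- σ i)))

  signedSum-neighbourhood : ∀ i (x : Fin k → ℤ) → (∀ c → σ c * x c ≡ - σ i * x c) →
                            signedSum x ≡ - σ i * ℤΣ.sum x
  signedSum-neighbourhood i x σx = trans (ℤΣ.sum-cong-≗ σx) (sym (ℤΣ.*-distribˡ-sum (- σ i) x))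

  closedNbhdRow : ∀ i c → row (inj₁ i) c ≡ basis i c + b2z (A i c)
  closedNbhdRow i c with i ≟ c
  ... | yes refl rewrite sameSide⇒nonadjacent {i} refl = refl
  ... | no _     = sym (ℤₚ.+-identityˡ _)

  signedSum-closedNbhd : ∀ i →
    signedSum (row (inj₁ i)) ≡ σ i * (+ 1 - ℤΣ.sum (λ c → b2z (A i c)))
  signedSum-closedNbhd i = begin
    signedSum (row (inj₁ i))
      ≡⟨ ℤΣ.sum-cong-≗ (λ c → cong (σ c *_) (closedNbhdRow i c)) ⟩
    signedSum (λ c → basis i c + b2z (A i c))
      ≡⟨ signedSum-+ (basis i) (λ c → b2z (A i c)) ⟩
    signedSum (basis i) + signedSum (λ c → b2z (A i c))
      ≡⟨ cong₂ _+_ (signedSum-basis i) (signedSum-neighbourhood i (λ c → b2z (A i c)) (σ-neighbour i)) ⟩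
    σ i + - σ i * degree
      ≡⟨ factor (σ i) degree ⟩
    σ i * (+ 1 - degree) ∎
    where
    open ≡-Reasoning
    degree : ℤ
    degree = ℤΣ.sum (λ c → b2z (A i c))
    factor : ∀ s d → s + - s * d ≡ s * (+ 1 - d)
    factor = solve-∀

  diagonalRow : ∀ i c → row (inj₂ (i , i)) c ≡ row (inj₁ i) c
  diagonalRow i c = cong b2z (∧-idem (closedNbhd adjV e i c))

  commonNbhdRow : ∀ {i j} → i ≢ j → side i ≡ side j → ∀ c →
                  row (inj₂ (i , j)) c ≡ b2z (A i c) * b2z (A j c)
  commonNbhdRow {i} {j} i≢j same c with i ≟ c | j ≟ c
  ... | yes refl | yes refl = ⊥-elim (i≢j refl)
  ... | yes refl | no _   rewrite sameSide⇒nonadjacent {j} {i} (sym same) = sym (ℤₚ.*-zeroʳ (b2z (A i i)))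
  ... | no _     | yes refl rewrite sameSide⇒nonadjacent {i} {j} same = refl
  ... | no _     | no _   = b2z-∧ (A i c) (A j c)

  signedSum-commonNbhd : ∀ {i j} → i ≢ j → side i ≡ side j →
    signedSum (row (inj₂ (i , j))) ≡ - σ i * ℤΣ.sum (λ c → b2z (A i c) * b2z (A j c))
  signedSum-commonNbhd {i} {j} i≢j same =
    trans (ℤΣ.sum-cong-≗ (λ c → cong (σ c *_) (commonNbhdRow i≢j same c)))
          (signedSum-neighbourhood i (λ c → b2z (A i c) * b2z (A j c)) σ-common)
    where
    σ-common : ∀ c → σ c * (b2z (A i c) * b2z (A j c)) ≡ - σ i * (b2z (A i c) * b2z (A j c))
    σ-common c = trans (sym (ℤₚ.*-assoc (σ c) (b2z (A i c)) (b2z (A j c))))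
                   (trans (cong (_* b2z (A j c)) (σ-neighbour i c)) (ℤₚ.*-assoc (- σ i) (b2z (A i c)) (b2z (A j c))))

  crossRow : ∀ {i j} → side i ≢ side j → ∀ c →
             row (inj₂ (i , j)) c ≡ b2z (A i j) * (basis i c + basis j c)
  crossRow {i} {j} opposite c with i ≟ c | j ≟ c
  ... | yes refl | yes refl = ⊥-elim (opposite refl)
  ... | yes refl | no _   rewrite adj-sym j i = sym (ℤₚ.*-identityʳ (b2z (A i j)))
  ... | no _     | yes refl rewrite ∧-identityʳ (A i j) = sym (ℤₚ.*-identityʳ (b2z (A i j)))
  ... | no _     | no _   with A i c in ic | A j c in jc
  ...   | false | _     = sym (ℤₚ.*-zeroʳ (b2z (A i j)))
  ...   | true  | false = sym (ℤₚ.*-zeroʳ (b2z (A i j)))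
  ...   | true  | true  = ⊥-elim (opposite (not-injective (trans (sym (adj-flip ic)) (adj-flip jc))))

  signedSum-cross : ∀ {i j} → side i ≢ side j → signedSum (row (inj₂ (i , j))) ≡ + 0
  signedSum-cross {i} {j} opposite = begin
    signedSum (row (inj₂ (i , j)))
      ≡⟨ ℤΣ.sum-cong-≗ (λ c → cong (σ c *_) (crossRow opposite c)) ⟩
    signedSum (λ c → b2z (A i j) * (basis i c + basis j c))
      ≡⟨ signedSum-* (b2z (A i j)) (λ c → basis i c + basis j c) ⟩
    b2z (A i j) * signedSum (λ c → basis i c + basis j c)
      ≡⟨ cong (b2z (A i j) *_) (signedSum-+ (basis i) (basis j)) ⟩
    b2z (A i j) * (signedSum (basis i) + signedSum (basis j))
      ≡⟨ cong (λ z → b2z (A i j) * z) (cong₂ _+_ (signedSum-basis i) (signedSum-basis j)) ⟩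
    b2z (A i j) * (σ i + σ j)
      ≡⟨ cong (λ z → b2z (A i j) * (σ i + z)) σj ⟩
    b2z (A i j) * (σ i + - σ i)
      ≡⟨ cong (b2z (A i j) *_) (ℤₚ.+-inverseʳ (σ i)) ⟩
    b2z (A i j) * + 0
      ≡⟨ ℤₚ.*-zeroʳ (b2z (A i j)) ⟩
    + 0 ∎
    where
    open ≡-Reasoning
    σj : σ j ≡ - σ i
    σj = trans (cong sgn (¬-not (opposite ∘ sym))) (sgn-not (side i))

  walk⇒kernelVector-inSpan : ∀ ℓ {i} → Star (λ a b → A a b ≡ true) i ℓ → InSpan row (kernelVector ℓ i)
  walk⇒kernelVector-inSpan ℓ ε = span-ext span-zero (λ d → sym (vanishes d))
    where vanishes : ∀ d → kernelVector ℓ ℓ d ≡ + 0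
          vanishes d = trans (cong (λ s → basis ℓ d - s * basis ℓ d) (sgn*sgn (side ℓ)))
                             (cancel (basis ℓ d))
            where cancel : ∀ x → x - + 1 * x ≡ + 0
                  cancel = solve-∀
  walk⇒kernelVector-inSpan ℓ {i} (_◅_ {j = j} adjacent walk) =
    span-ext (inSpan-- (inSpan-row (inj₂ (i , j))) (walk⇒kernelVector-inSpan ℓ walk)) telescope
    where
    σj : σ j ≡ - σ i
    σj = trans (cong sgn (adj-flip adjacent)) (sgn-not (side i))
    rearrange : ∀ p q s t f → + 1 * (p + q) - (q - (- s) * t * f) ≡ p - s * t * f
    rearrange = solve-∀
    telescope : ∀ d → row (inj₂ (i , j)) d - kernelVector ℓ j d ≡ kernelVector ℓ i d
    telescope d
      rewrite crossRow (λ same → not-¬ refl (trans same (adj-flip adjacent))) d | adjacent | σj =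
      rearrange (basis i d) (basis j d) (σ i) (σ ℓ) (basis ℓ d)

-- Counting in tensor products

module _ {n m : ℕ} where

  sumProduct : (Fin n × Fin m → ℤ) → ℤ
  sumProduct f = ℤΣ.sum (λ a → ℤΣ.sum (λ b → f (a , b)))

  sumProduct-cong : ∀ {f g : Fin n × Fin m → ℤ} → (∀ y → f y ≡ g y) → sumProduct f ≡ sumProduct g
  sumProduct-cong f≗g = ℤΣ.sum-cong-≗ (λ a → ℤΣ.sum-cong-≗ (λ b → f≗g (a , b)))

  pointIndicator : Fin n × Fin m → Fin n × Fin m → ℤ
  pointIndicator (a , b) (a′ , b′) = basis a a′ * basis b b′

  pointIndicator-diag : ∀ y → pointIndicator y y ≡ + 1
  pointIndicator-diag (a , b) rewrite basis-diag a | basis-diag b = refl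

  pointIndicator-≢ : ∀ {y y′} → y ≢ y′ → pointIndicator y y′ ≡ + 0
  pointIndicator-≢ {a , b} {a′ , b′} y≢y′ with a ≟ a′ | b ≟ b′
  ... | yes refl | yes refl = ⊥-elim (y≢y′ refl)
  ... | yes _    | no _     = refl
  ... | no _     | _        = refl

  sumProduct-*pointIndicator : ∀ (f : Fin n × Fin m → ℤ) x → sumProduct (λ y → f y * pointIndicator y x) ≡ f x
  sumProduct-*pointIndicator f (a₀ , b₀) = begin
    ℤΣ.sum (λ a → ℤΣ.sum (λ b → f (a , b) * (basis a a₀ * basis b b₀)))
      ≡⟨ ℤΣ.sum-cong-≗ (λ a → ℤΣ.sum-cong-≗ (λ b → regroup (f (a , b)) (basis a a₀) (basis b b₀))) ⟩
    ℤΣ.sum (λ a → ℤΣ.sum (λ b → f (a , b) * basis b b₀ * basis a a₀))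
      ≡⟨ ℤΣ.sum-cong-≗ (λ a → ℤΣ.*-distribʳ-sum (basis a a₀) (λ b → f (a , b) * basis b b₀)) ⟨
    ℤΣ.sum (λ a → ℤΣ.sum (λ b → f (a , b) * basis b b₀) * basis a a₀)
      ≡⟨ ℤΣ.sum-cong-≗ (λ a → cong (_* basis a a₀) (∑-*basis (λ b → f (a , b)) b₀)) ⟩
    ℤΣ.sum (λ a → f (a , b₀) * basis a a₀)
      ≡⟨ ∑-*basis (λ a → f (a , b₀)) a₀ ⟩
    f (a₀ , b₀) ∎
    where
    open ≡-Reasoning
    regroup : ∀ x p q → x * (p * q) ≡ x * q * p
    regroup = solve-∀

  ∑-reindex : ∀ {k} (S : Fin n × Fin m → Bool) (e : Fin k → Fin n × Fin m) →
    (∀ i j → e i ≡ e j → i ≡ j) → (∀ y → S y ≡ true → ∃[ i ] e i ≡ y) →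
    ∀ (f : Fin n × Fin m → ℤ) → (∀ y → S y ≡ false → f y ≡ + 0) → ℤΣ.sum (λ c → f (e c)) ≡ sumProduct f
  ∑-reindex {k} S e injective onto f vanishes = begin
    ℤΣ.sum (λ c → f (e c))
      ≡⟨ ℤΣ.sum-cong-≗ (λ c → sumProduct-*pointIndicator f (e c)) ⟨
    ℤΣ.sum (λ c → ℤΣ.sum (λ a → ℤΣ.sum (λ b → f (a , b) * pointIndicator (a , b) (e c))))
      ≡⟨ ℤΣ.∑-comm (λ c a → ℤΣ.sum (λ b → f (a , b) * pointIndicator (a , b) (e c))) ⟩
    ℤΣ.sum (λ a → ℤΣ.sum (λ c → ℤΣ.sum (λ b → f (a , b) * pointIndicator (a , b) (e c))))
      ≡⟨ ℤΣ.sum-cong-≗ (λ a → ℤΣ.∑-comm (λ c b → f (a , b) * pointIndicator (a , b) (e c))) ⟩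
    sumProduct (λ y → ℤΣ.sum (λ c → f y * pointIndicator y (e c)))
      ≡⟨ sumProduct-cong (λ y → ℤΣ.*-distribˡ-sum (f y) (λ c → pointIndicator y (e c))) ⟨
    sumProduct (λ y → f y * ℤΣ.sum (λ c → pointIndicator y (e c)))
      ≡⟨ sumProduct-cong counted ⟩
    sumProduct f ∎
    where
    open ≡-Reasoning
    hitsOnce : ∀ {i} y → e i ≡ y → ∀ c → pointIndicator y (e c) ≡ + 1 * basis c i
    hitsOnce {i} y refl c with c ≟ i
    ... | yes refl = pointIndicator-diag (e i)
    ... | no c≢i   = pointIndicator-≢ (c≢i ∘ sym ∘ injective i c)
    counted : ∀ y → f y * ℤΣ.sum (λ c → pointIndicator y (e c)) ≡ f y
    counted y with S y in y∈S
    ... | false rewrite vanishes y y∈S = ℤₚ.*-zeroˡ (ℤΣ.sum (λ c → pointIndicator y (e c)))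
    ... | true with onto y y∈S
    ...   | i , eᵢ≡y = trans (cong (f y *_) (trans (ℤΣ.sum-cong-≗ (hitsOnce y eᵢ≡y)) (∑-*basis (λ _ → + 1) i)))
                             (ℤₚ.*-identityʳ (f y))

  sumProduct-separable : ∀ (p : Fin n → ℤ) (q : Fin m → ℤ) →
    sumProduct (λ y → p (proj₁ y) * q (proj₂ y)) ≡ ℤΣ.sum p * ℤΣ.sum q
  sumProduct-separable p q = begin
    ℤΣ.sum (λ a → ℤΣ.sum (λ b → p a * q b)) ≡⟨ ℤΣ.sum-cong-≗ (λ a → ℤΣ.*-distribˡ-sum (p a) q) ⟨
    ℤΣ.sum (λ a → p a * ℤΣ.sum q)           ≡⟨ ℤΣ.*-distribʳ-sum (ℤΣ.sum q) p ⟨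
    ℤΣ.sum p * ℤΣ.sum q                     ∎
    where open ≡-Reasoning

count-positive : ∀ {k} {f : Fin k → Bool} → ∃[ i ] f i ≡ true → 1 ℕ.≤ count k f
count-positive {suc k} {f} (zero , fᵢ)  rewrite fᵢ = s≤s z≤n
count-positive {suc k} {f} (suc i , fᵢ) =
  ℕₚ.≤-trans (count-positive (i , fᵢ)) (ℕₚ.m≤n+m _ (if f zero then 1 else 0))

∑-b2z : ∀ n (f : Fin n → Bool) → ℤΣ.sum (λ i → b2z (f i)) ≡ + count n f
∑-b2z zero    f = refl
∑-b2z (suc n) f = trans (cong (λ z → b2z (f zero) + z) (∑-b2z n (f ∘ suc))) (head (f zero))
  where head : ∀ b → b2z b + + count n (f ∘ suc) ≡ + ((if b then 1 else 0) ℕ.+ count n (f ∘ suc))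
        head false = ℤₚ.+-identityˡ _
        head true  = sym (ℤₚ.pos-+ 1 (count n (f ∘ suc)))

module _ {n m} (Γ : Graph n) (Λ : Graph m) where

  private
    T : Fin n × Fin m → Fin n × Fin m → Bool
    T = tensorAdj Γ Λ

    countProduct : ∀ (p : Fin n → Bool) (q : Fin m → Bool) →
      sumProduct (λ y → b2z (p (proj₁ y)) * b2z (q (proj₂ y))) ≡ + (count n p ℕ.* count m q)
    countProduct p q = begin
      sumProduct (λ y → b2z (p (proj₁ y)) * b2z (q (proj₂ y)))
        ≡⟨ sumProduct-separable (b2z ∘ p) (b2z ∘ q) ⟩
      ℤΣ.sum (b2z ∘ p) * ℤΣ.sum (b2z ∘ q)
        ≡⟨ cong₂ _*_ (∑-b2z n p) (∑-b2z m q) ⟩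
      + count n p * + count m q
        ≡⟨ ℤₚ.pos-* (count n p) (count m q) ⟨
      + (count n p ℕ.* count m q) ∎
      where open ≡-Reasoning

  sumProduct-tensorNbhd : ∀ x →
    sumProduct (λ y → b2z (T x y)) ≡ + (deg Γ (proj₁ x) ℕ.* deg Λ (proj₂ x))
  sumProduct-tensorNbhd (g , l) =
    trans (sumProduct-cong (λ y → b2z-∧ (adj Γ g (proj₁ y)) (adj Λ l (proj₂ y))))
          (countProduct (adj Γ g) (adj Λ l))

  sumProduct-tensorCommon : ∀ x x′ →
    sumProduct (λ y → b2z (T x y) * b2z (T x′ y)) ≡
    + (common Γ (proj₁ x) (proj₁ x′) ℕ.* common Λ (proj₂ x) (proj₂ x′))
  sumProduct-tensorCommon (g , l) (g′ , l′) =
    trans (sumProduct-cong shuffle)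
          (countProduct (λ a → adj Γ g a ∧ adj Γ g′ a) (λ b → adj Λ l b ∧ adj Λ l′ b))
    where
    interchange : ∀ p q p′ q′ → (p * q) * (p′ * q′) ≡ (p * p′) * (q * q′)
    interchange = solve-∀
    shuffle : ∀ y → b2z (T (g , l) y) * b2z (T (g′ , l′) y) ≡
                    b2z (adj Γ g (proj₁ y) ∧ adj Γ g′ (proj₁ y)) * b2z (adj Λ l (proj₂ y) ∧ adj Λ l′ (proj₂ y))
    shuffle (a , b) = begin
      b2z (adj Γ g a ∧ adj Λ l b) * b2z (adj Γ g′ a ∧ adj Λ l′ b)
        ≡⟨ cong₂ _*_ (b2z-∧ (adj Γ g a) (adj Λ l b)) (b2z-∧ (adj Γ g′ a) (adj Λ l′ b)) ⟩
      b2z (adj Γ g a) * b2z (adj Λ l b) * (b2z (adj Γ g′ a) * b2z (adj Λ l′ b))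
        ≡⟨ interchange (b2z (adj Γ g a)) (b2z (adj Λ l b)) (b2z (adj Γ g′ a)) (b2z (adj Λ l′ b)) ⟩
      b2z (adj Γ g a) * b2z (adj Γ g′ a) * (b2z (adj Λ l b) * b2z (adj Λ l′ b))
        ≡⟨ cong₂ _*_ (b2z-∧ (adj Γ g a) (adj Γ g′ a)) (b2z-∧ (adj Λ l b) (adj Λ l′ b)) ⟨
      b2z (adj Γ g a ∧ adj Γ g′ a) * b2z (adj Λ l b ∧ adj Λ l′ b) ∎
      where open ≡-Reasoning

-- Components of the tensor product

xor-cancelʳ : ∀ p q x → p xor x ≡ q xor x → p ≡ q
xor-cancelʳ false false _ _  = refl
xor-cancelʳ true  true  _ _  = refl
xor-cancelʳ false true  x eq = ⊥-elim (not-¬ refl eq)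
xor-cancelʳ true  false x eq = ⊥-elim (not-¬ refl (sym eq))

bPart-xor : ∀ c p x → bPart c (p xor x) ≡ p xor bPart c x
bPart-xor c₁ p     x = refl
bPart-xor c₂ false x = refl
bPart-xor c₂ true  x = refl

parity : ∀ {A : Set} {R : A → A → Set} {x y} → Star R x y → Bool
parity ε       = false
parity (_ ◅ p) = not (parity p)

module _ {n} (G : Graph n) where

  hasNeighbour : Connected G → HasEdge G → ∀ v → ∃[ w ] Adj G v w
  hasNeighbour connected (u , w , uw) v with connected v u
  ... | ε                    = w , uw
  ... | _◅_ {j = w′} vw′ _   = w′ , vw′

  module _ {side : Fin n → Bool} (bipartite : IsBipartition G side) where

    side-adj : ∀ {u v} → Adj G u v → side v ≡ not (side u)
    side-adj {u} {v} uv = ¬-not (bipartite u v uv ∘ sym)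

    side-walk : ∀ {u v} (p : Star (Adj G) u v) → side v ≡ parity p xor side u
    side-walk ε = refl
    side-walk {u} (_◅_ {j = w} uw p) = begin
      side _                          ≡⟨ side-walk p ⟩
      parity p xor side w             ≡⟨ cong (parity p xor_) (side-adj uw) ⟩
      parity p xor not (side u)       ≡⟨ not-distribʳ-xor (parity p) (side u) ⟨
      not (parity p xor side u)       ≡⟨ not-distribˡ-xor (parity p) (side u) ⟩
      not (parity p) xor side u       ∎
      where open ≡-Reasoning

module BipartiteTensor {n m} (Γ : Graph n) (Λ : Graph m) {sΓ : Fin n → Bool} {sΛ : Fin m → Bool}
  (bipΓ : IsBipartition Γ sΓ) (bipΛ : IsBipartition Λ sΛ) where

  T : Fin n × Fin m → Fin n × Fin m → Bool
  T = tensorAdj Γ Λ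

  inComponent : Comp → Fin n × Fin m → Bool
  inComponent c (g , l) = eqB (sΛ l) (bPart c (sΓ g))

  inComponent≗comp₁ : ∀ p → inComponent c₁ p ≡ comp₁ sΓ sΛ p
  inComponent≗comp₁ (g , l) with sΓ g | sΛ l
  ... | false | false = refl
  ... | false | true  = refl
  ... | true  | false = refl
  ... | true  | true  = refl

  inComponent≗comp₂ : ∀ p → inComponent c₂ p ≡ comp₂ sΓ sΛ p
  inComponent≗comp₂ (g , l) with sΓ g | sΛ l
  ... | false | false = refl
  ... | false | true  = refl
  ... | true  | false = refl
  ... | true  | true  = refl

  comp₁-or-comp₂ : ∀ p → comp₁ sΓ sΛ p ≡ true ⊎ comp₂ sΓ sΛ p ≡ true
  comp₁-or-comp₂ (g , l) with sΓ g | sΛ l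
  ... | false | false = inj₁ refl
  ... | false | true  = inj₂ refl
  ... | true  | false = inj₂ refl
  ... | true  | true  = inj₁ refl

  comp₁⇒¬comp₂ : ∀ p → comp₁ sΓ sΛ p ≡ true → comp₂ sΓ sΛ p ≡ false
  comp₁⇒¬comp₂ (g , l) _  with sΓ g | sΛ l
  comp₁⇒¬comp₂ (g , l) _  | false | false = refl
  comp₁⇒¬comp₂ (g , l) () | false | true
  comp₁⇒¬comp₂ (g , l) () | true  | false
  comp₁⇒¬comp₂ (g , l) _  | true  | true  = refl

  T-sym : ∀ x y → T x y ≡ T y x
  T-sym (g , l) (g′ , l′) = cong₂ _∧_ (Graph.sym Γ g g′) (Graph.sym Λ l l′)

  T-side : ∀ {x y} → T x y ≡ true → sΓ (proj₁ y) ≡ not (sΓ (proj₁ x))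
  T-side {g , l} {g′ , l′} xy with adj Γ g g′ in gg′
  ... | true = side-adj Γ bipΓ gg′

  inComponent-closed : ∀ c x y → inComponent c x ≡ true → T x y ≡ true → inComponent c y ≡ true
  inComponent-closed c (g , l) (g′ , l′) x∈c xy with adj Γ g g′ in gg′ | adj Λ l l′ in ll′
  ... | true | true = eqB-complete (begin
    sΛ l′                  ≡⟨ side-adj Λ bipΛ ll′ ⟩
    not (sΛ l)             ≡⟨ cong not (eqB-sound x∈c) ⟩
    not (bPart c (sΓ g))   ≡⟨ bPart-xor c true (sΓ g) ⟨
    bPart c (not (sΓ g))   ≡⟨ cong (bPart c) (side-adj Γ bipΓ gg′) ⟨
    bPart c (sΓ g′)        ∎)
    where open ≡-Reasoning

  T-outside : ∀ c {x y} → inComponent c x ≡ true → inComponent c y ≡ false → T x y ≡ false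
  T-outside c {x} {y} x∈c y∉c with T x y in xy
  ... | false = refl
  ... | true  = ⊥-elim (not-¬ refl (trans (sym y∉c) (inComponent-closed c x y x∈c xy)))

  module _ (conΓ : Connected Γ) (conΛ : Connected Λ) (edΓ : HasEdge Γ) (edΛ : HasEdge Λ) where

    private
      TEdge : Fin n × Fin m → Fin n × Fin m → Set
      TEdge x y = T x y ≡ true

      ∧-intro : ∀ {x y} → x ≡ true → y ≡ true → x ∧ y ≡ true
      ∧-intro refl refl = refl

    -- Walks of equal parity are zipped step by step; the shorter one is padded by going
    -- back and forth along an edge, which exists at every vertex.
    zipWalks : ∀ {g g′ l l′} (p : Star (Adj Γ) g g′) (q : Star (Adj Λ) l l′) →
               parity p ≡ parity q → Star TEdge (g , l) (g′ , l′)
    zipWalks ε ε _ = ε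
    zipWalks (a ◅ p) (b ◅ q) eq = ∧-intro a b ◅ zipWalks p q (not-injective eq)
    zipWalks {g} ε (b ◅ b′ ◅ q) eq with hasNeighbour Γ conΓ edΓ g
    ... | h , gh = ∧-intro gh b ◅ ∧-intro (trans (Graph.sym Γ h g) gh) b′ ◅
                   zipWalks ε q (trans eq (not-involutive (parity q)))
    zipWalks {l = l} (a ◅ a′ ◅ p) ε eq with hasNeighbour Λ conΛ edΛ l
    ... | h , lh = ∧-intro a lh ◅ ∧-intro a′ (trans (Graph.sym Λ h l) lh) ◅
                   zipWalks p ε (trans (sym (not-involutive (parity p))) eq)
    zipWalks ε (_ ◅ ε) ()
    zipWalks (_ ◅ ε) ε ()

    inComponent-walk : ∀ c {x y} → inComponent c x ≡ true → Star TEdge x y →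
                       Star (λ a b → T a b ≡ true × inComponent c b ≡ true) x y
    inComponent-walk c x∈c ε = ε
    inComponent-walk c {x} x∈c (_◅_ {j = z} xz walk) =
      (xz , z∈c) ◅ inComponent-walk c z∈c walk
      where z∈c = inComponent-closed c x z x∈c xz

    inComponent-connected : ∀ c x y → inComponent c x ≡ true → inComponent c y ≡ true →
                            Star (λ a b → T a b ≡ true × inComponent c b ≡ true) x y
    inComponent-connected c (g , l) (g′ , l′) x∈c y∈c =
      inComponent-walk c x∈c (zipWalks p q (xor-cancelʳ (parity p) (parity q) (bPart c (sΓ g)) sameParity))
      where
      p : Star (Adj Γ) g g′
      p = conΓ g g′
      q : Star (Adj Λ) l l′
      q = conΛ l l′
      open ≡-Reasoning
      sameParity : parity p xor bPart c (sΓ g) ≡ parity q xor bPart c (sΓ g)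
      sameParity = begin
        parity p xor bPart c (sΓ g) ≡⟨ bPart-xor c (parity p) (sΓ g) ⟨
        bPart c (parity p xor sΓ g) ≡⟨ cong (bPart c) (side-walk Γ bipΓ p) ⟨
        bPart c (sΓ g′)             ≡⟨ eqB-sound y∈c ⟨
        sΛ l′                       ≡⟨ side-walk Λ bipΛ q ⟩
        parity q xor sΛ l           ≡⟨ cong (parity q xor_) (eqB-sound x∈c) ⟩
        parity q xor bPart c (sΓ g) ∎

    inComponent-nonempty : ∀ c → ∃[ x ] inComponent c x ≡ true
    inComponent-nonempty c = choose edΓ edΛ
      where
      choose : HasEdge Γ → HasEdge Λ → ∃[ x ] inComponent c x ≡ true
      choose (g , g′ , gg′) (l , _) with sΛ l 𝔹.≟ bPart c (sΓ g)
      ... | yes onSide = (g , l) , eqB-complete onSide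
      ... | no offSide = (g′ , l) , eqB-complete (begin
        sΛ l                  ≡⟨ ¬-not offSide ⟩
        not (bPart c (sΓ g))  ≡⟨ bPart-xor c true (sΓ g) ⟨
        bPart c (not (sΓ g))  ≡⟨ cong (bPart c) (side-adj Γ bipΓ gg′) ⟨
        bPart c (sΓ g′)       ∎)
        where open ≡-Reasoning

    inComponent-isConnectedComponent : ∀ c → IsConnectedComponent T (inComponent c)
    inComponent-isConnectedComponent c =
      inComponent-nonempty c , inComponent-closed c , inComponent-connected c

    degreeProduct : Fin n × Fin m → ℕ
    degreeProduct (g , l) = deg Γ g ℕ.* deg Λ l

    commonProduct : Fin n × Fin m → Fin n × Fin m → ℕ
    commonProduct (g , l) (g′ , l′) = common Γ g g′ ℕ.* common Λ l l′

    degreeProduct-positive : ∀ x → 1 ℕ.≤ degreeProduct x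
    degreeProduct-positive (g , l) = ℕₚ.*-mono-≤ {1} {deg Γ g} {1} {deg Λ l}
      (count-positive (hasNeighbour Γ conΓ edΓ g)) (count-positive (hasNeighbour Λ conΛ edΛ l))

    module _ (c : Comp) {K : ℕ} (e : Fin (suc K) → Fin n × Fin m)
             (injective : ∀ i j → e i ≡ e j → i ≡ j)
             (inside : ∀ i → inComponent c (e i) ≡ true)
             (onto : ∀ v → inComponent c v ≡ true → ∃[ i ] e i ≡ v) where

      side : Fin (suc K) → Bool
      side i = sΓ (proj₁ (e i))

      open SignedSum side
      open BipartiteRARows T e side (λ i j → T-sym (e i) (e j)) T-side

      ℓ : Fin (suc K)
      ℓ = fromℕ K

      ∑-neighbours : ∀ i → ℤΣ.sum (λ d → b2z (A i d)) ≡ + degreeProduct (e i)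
      ∑-neighbours i =
        trans (∑-reindex (inComponent c) e injective onto (λ y → b2z (T (e i) y))
                         (λ y y∉c → cong b2z (T-outside c (inside i) y∉c)))
              (sumProduct-tensorNbhd Γ Λ (e i))

      ∑-commonNeighbours : ∀ i j → ℤΣ.sum (λ d → b2z (A i d) * b2z (A j d)) ≡ + commonProduct (e i) (e j)
      ∑-commonNeighbours i j =
        trans (∑-reindex (inComponent c) e injective onto (λ y → b2z (T (e i) y) * b2z (T (e j) y))
                         (λ y y∉c → cong (λ b → b2z b * b2z (T (e j) y)) (T-outside c (inside i) y∉c)))
              (sumProduct-tensorCommon Γ Λ (e i) (e j))

      signedSum-closedNbhd′ : ∀ i →
        signedSum (row (inj₁ i)) ≡ sgn (not (side i)) * + (degreeProduct (e i) ∸ 1)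
      signedSum-closedNbhd′ i = begin
        signedSum (row (inj₁ i))          ≡⟨ signedSum-closedNbhd i ⟩
        σ i * (+ 1 - ℤΣ.sum (λ d → b2z (A i d)))
                                          ≡⟨ cong (λ z → σ i * (+ 1 - z)) (∑-neighbours i) ⟩
        σ i * (+ 1 - + D)                 ≡⟨ cong (λ z → σ i * (+ 1 - z)) D≡D-1+1 ⟩
        σ i * (+ 1 - (+ (D ∸ 1) + + 1))   ≡⟨ cancel (σ i) (+ (D ∸ 1)) ⟩
        - σ i * + (D ∸ 1)                 ≡⟨ cong (_* + (D ∸ 1)) (sgn-not (side i)) ⟨
        sgn (not (side i)) * + (D ∸ 1)    ∎
        where
        open ≡-Reasoning
        D : ℕ
        D = degreeProduct (e i)
        D≡D-1+1 : + D ≡ + (D ∸ 1) + + 1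
        D≡D-1+1 = trans (cong +_ (sym (ℕₚ.m∸n+n≡m (degreeProduct-positive (e i))))) (ℤₚ.pos-+ (D ∸ 1) 1)
        cancel : ∀ s a → s * (+ 1 - (a + + 1)) ≡ - s * a
        cancel = solve-∀

      signedSum-commonNbhd′ : ∀ {i j} → i ≢ j → side i ≡ side j →
        signedSum (row (inj₂ (i , j))) ≡ sgn (not (side i)) * + commonProduct (e i) (e j)
      signedSum-commonNbhd′ {i} {j} i≢j same =
        trans (signedSum-commonNbhd i≢j same)
              (cong₂ _*_ (sym (sgn-not (side i))) (∑-commonNeighbours i j))

      private
        μc : ℕ
        μc = μ Γ sΓ Λ sΛ c

      δGenerator : Fin n → Fin m → ℕ
      δGenerator v l = if inComponent c (v , l) then deg Γ v ℕ.* deg Λ l ∸ 1 else 0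

      κGenerator : Fin n → Fin n → Fin m → Fin m → ℕ
      κGenerator u v l₁ l₂ =
        if eqB (sΓ u) (sΓ v) ∧ inComponent c (u , l₁) ∧ inComponent c (u , l₂) ∧ not (⌊ u ≟ v ⌋ ∧ ⌊ l₁ ≟ l₂ ⌋)
        then common Γ u v ℕ.* common Λ l₁ l₂ else 0

      μ∣δGenerator : ∀ v l → μc ℕ∣.∣ δGenerator v l
      μ∣δGenerator v l =
        ∣-trans (gcd[m,n]∣m (δ Γ sΓ Λ sΛ c) (κ Γ sΓ Λ sΛ c))
        (∣-trans (gcdAll∣ n (λ v → gcdAll m (δGenerator v)) v) (gcdAll∣ m (δGenerator v) l))

      μ∣κGenerator : ∀ u v l₁ l₂ → μc ℕ∣.∣ κGenerator u v l₁ l₂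
      μ∣κGenerator u v l₁ l₂ =
        ∣-trans (gcd[m,n]∣n (δ Γ sΓ Λ sΛ c) (κ Γ sΓ Λ sΛ c))
        (∣-trans (gcdAll∣ n (λ u → gcdAll n λ v → gcdAll m λ l₁ → gcdAll m (κGenerator u v l₁)) u)
        (∣-trans (gcdAll∣ n (λ v → gcdAll m λ l₁ → gcdAll m (κGenerator u v l₁)) v)
        (∣-trans (gcdAll∣ m (λ l₁ → gcdAll m (κGenerator u v l₁)) l₁)
                 (gcdAll∣ m (κGenerator u v l₁) l₂))))

      δGenerator-inside : ∀ x → inComponent c x ≡ true →
                          δGenerator (proj₁ x) (proj₂ x) ≡ degreeProduct x ∸ 1
      δGenerator-inside x x∈c rewrite x∈c = refl

      κGenerator-inside : ∀ x y → x ≢ y → sΓ (proj₁ x) ≡ sΓ (proj₁ y) →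
        inComponent c x ≡ true → inComponent c y ≡ true →
        κGenerator (proj₁ x) (proj₁ y) (proj₂ x) (proj₂ y) ≡ commonProduct x y
      κGenerator-inside (g , l) (g′ , l′) x≢y same x∈c y∈c
        rewrite eqB-complete same | x∈c | same | y∈c | ≢⇒≟×≟-false x≢y = refl

      μ∣signedRow : ∀ r s {t} → signedSum (row r) ≡ sgn s * + t → μc ℕ∣.∣ t → + μc ℤ∣.∣ signedSum (row r)
      μ∣signedRow r s eq μ∣t = subst (+ μc ℤ∣.∣_) (sym eq) (ℤ∣.∣n⇒∣m*n (sgn s) (ℤ∣.∣ᵤ⇒∣ μ∣t))

      μ∣row : ∀ r → + μc ℤ∣.∣ signedSum (row r)
      μ∣row (inj₁ i) =
        μ∣signedRow (inj₁ i) (not (side i)) (signedSum-closedNbhd′ i)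
          (subst (μc ℕ∣.∣_) (δGenerator-inside (e i) (inside i)) (μ∣δGenerator (proj₁ (e i)) (proj₂ (e i))))
      μ∣row (inj₂ (i , j)) with i ≟ j | side i 𝔹.≟ side j
      ... | yes refl | _ =
        subst (+ μc ℤ∣.∣_) (ℤΣ.sum-cong-≗ (λ d → cong (σ d *_) (sym (diagonalRow i d)))) (μ∣row (inj₁ i))
      ... | no i≢j | yes same =
        μ∣signedRow (inj₂ (i , j)) (not (side i)) (signedSum-commonNbhd′ i≢j same)
          (subst (μc ℕ∣.∣_) (κGenerator-inside (e i) (e j) (i≢j ∘ injective i j) same (inside i) (inside j))
                 (μ∣κGenerator (proj₁ (e i)) (proj₁ (e j)) (proj₂ (e i)) (proj₂ (e j))))
      ... | no _ | no opposite =
        subst (+ μc ℤ∣.∣_) (sym (signedSum-cross opposite)) (divides (+ 0) (sym (ℤₚ.*-zeroˡ (+ μc))))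

      indexWalk : ∀ {x y} → Star (λ a b → T a b ≡ true × inComponent c b ≡ true) x y →
                  ∀ {i j} → e i ≡ x → e j ≡ y → Star (λ a b → A a b ≡ true) i j
      indexWalk ε {i} {j} eᵢ≡x eⱼ≡x = subst (Star _ i) (injective i j (trans eᵢ≡x (sym eⱼ≡x))) ε
      indexWalk (_◅_ {j = z} (xz , z∈c) walk) {i} eᵢ≡x eⱼ≡y with onto z z∈c
      ... | i′ , eᵢ′≡z = subst₂ (λ a b → T a b ≡ true) (sym eᵢ≡x) (sym eᵢ′≡z) xz ◅ indexWalk walk eᵢ′≡z eⱼ≡y

      kernel⊆row : ∀ i → InSpan row (kernelVector ℓ i)
      kernel⊆row i = walk⇒kernelVector-inSpan ℓ (indexWalk (inComponent-connected c (e i) (e ℓ) (inside i) (inside ℓ)) refl refl)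

      inSpan-signedRow : ∀ r s {t} → signedSum (row r) ≡ sgn s * + t → InSpan row (λ d → + t * basis ℓ d)
      inSpan-signedRow r s {t} eq =
        subst (λ a → InSpan row (λ d → + a * basis ℓ d)) ∣sgn*t∣≡t
          (inSpan-∣∣ (basis ℓ) (sgn s * + t)
            (subst (λ z → InSpan row (λ d → z * basis ℓ d)) eq (inSpan-signedSum*basis ℓ row kernel⊆row (inSpan-row r))))
        where ∣sgn*t∣≡t : ∣ sgn s * + t ∣ ≡ t
              ∣sgn*t∣≡t = trans (ℤₚ.abs-* (sgn s) (+ t)) (trans (cong (ℕ._* t) (∣sgn∣ s)) (ℕₚ.*-identityˡ t))

      private
        zeroMultiple : InSpan row (λ d → + 0 * basis ℓ d)
        zeroMultiple = span-ext span-zero (λ d → sym (ℤₚ.*-zeroˡ (basis ℓ d)))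

      δGenerator-inSpan : ∀ v l → InSpan row (λ d → + δGenerator v l * basis ℓ d)
      δGenerator-inSpan v l with inComponent c (v , l) in v,l∈c
      ... | false = zeroMultiple
      ... | true with onto (v , l) v,l∈c
      ...   | i , refl = inSpan-signedRow (inj₁ i) (not (side i)) (signedSum-closedNbhd′ i)

      κGenerator-inSpan : ∀ u v l₁ l₂ → InSpan row (λ d → + κGenerator u v l₁ l₂ * basis ℓ d)
      κGenerator-inSpan u v l₁ l₂
        with eqB (sΓ u) (sΓ v) in same | inComponent c (u , l₁) in x∈c | inComponent c (u , l₂) in y∈c
           | not (⌊ u ≟ v ⌋ ∧ ⌊ l₁ ≟ l₂ ⌋) in distinct
      ... | false | _     | _     | _     = zeroMultiple
      ... | true  | false | _     | _     = zeroMultiple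
      ... | true  | true  | false | _     = zeroMultiple
      ... | true  | true  | true  | false = zeroMultiple
      ... | true  | true  | true  | true
        with onto (u , l₁) x∈c | onto (v , l₂) (subst (λ a → eqB (sΛ l₂) (bPart c a) ≡ true) (eqB-sound same) y∈c)
      ...   | i , refl | j , refl =
        inSpan-signedRow (inj₂ (i , j)) (not (side i)) (signedSum-commonNbhd′ i≢j (eqB-sound same))
        where
        i≢j : i ≢ j
        i≢j refl = not-¬ refl (trans (sym distinct) (cong₂ (λ a b → not (a ∧ b)) (⌊≟⌋-refl u) (⌊≟⌋-refl l₁)))

      μℓ∈row : InSpan row (λ d → + μc * basis ℓ d)
      μℓ∈row = inSpan-gcd (basis ℓ) {δ Γ sΓ Λ sΛ c} {κ Γ sΓ Λ sΛ c}
        (inSpan-gcdAll (basis ℓ) n _ λ v → inSpan-gcdAll (basis ℓ) m _ (δGenerator-inSpan v))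
        (inSpan-gcdAll (basis ℓ) n _ λ u → inSpan-gcdAll (basis ℓ) n _ λ v →
         inSpan-gcdAll (basis ℓ) m _ λ l₁ → inSpan-gcdAll (basis ℓ) m _ (κGenerator-inSpan u v l₁))

      hnfDiagonal-component : HNFDiagonalIs row (diagTarget (suc K) μc)
      hnfDiagonal-component = hnfDiagonal-signedSumLattice row side μc μ∣row kernel⊆row μℓ∈row

    inComponent-isRA : ∀ c → IsRA T (inComponent c) (μ Γ sΓ Λ sΛ c)
    inComponent-isRA c zero e _ _ onto with inComponent-nonempty c
    ... | x , x∈c with onto x x∈c
    ...   | () , _
    inComponent-isRA c (suc K) e injective inside onto = hnfDiagonal-component c e injective inside onto

module _ {V : Set} {adjV : V → V → Bool} {S S′ : V → Bool} (S≗S′ : ∀ x → S x ≡ S′ x) where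

  private
    to : ∀ {x} → S x ≡ true → S′ x ≡ true
    to {x} = trans (sym (S≗S′ x))

    from : ∀ {x} → S′ x ≡ true → S x ≡ true
    from {x} = trans (S≗S′ x)

  IsConnectedComponent-resp : IsConnectedComponent adjV S → IsConnectedComponent adjV S′
  IsConnectedComponent-resp ((x , x∈S) , closed , connected) =
    (x , to x∈S) ,
    (λ x y x∈S′ xy → to (closed x y (from x∈S′) xy)) ,
    (λ x y x∈S′ y∈S′ → Star.map (λ (xy , y∈S) → xy , to y∈S) (connected x y (from x∈S′) (from y∈S′)))

  IsRA-resp : ∀ {μ} → IsRA adjV S μ → IsRA adjV S′ μ
  IsRA-resp isRA k e injective inside onto = isRA k e injective (from ∘ inside) (λ v → onto v ∘ to)

mainTheorem11 : ∀ {n m} (Γ : Graph n) (Λ : Graph m)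
                  (sΓ : Fin n → Bool) (sΛ : Fin m → Bool) →
                  IsBipartition Γ sΓ → IsBipartition Λ sΛ →
                  Connected Γ → Connected Λ →
                  HasEdge Γ → HasEdge Λ →
                  (∀ p → comp₁ sΓ sΛ p ≡ true ⊎ comp₂ sΓ sΛ p ≡ true)
                  × (∀ p → comp₁ sΓ sΛ p ≡ true → comp₂ sΓ sΛ p ≡ false)
                  × IsConnectedComponent (tensorAdj Γ Λ) (comp₁ sΓ sΛ)
                  × IsConnectedComponent (tensorAdj Γ Λ) (comp₂ sΓ sΛ)
                  × IsRA (tensorAdj Γ Λ) (comp₁ sΓ sΛ) (μ Γ sΓ Λ sΛ c₁)
                  × IsRA (tensorAdj Γ Λ) (comp₂ sΓ sΛ) (μ Γ sΓ Λ sΛ c₂)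
mainTheorem11 Γ Λ sΓ sΛ bipΓ bipΛ conΓ conΛ edΓ edΛ =
  comp₁-or-comp₂ ,
  comp₁⇒¬comp₂ ,
  IsConnectedComponent-resp inComponent≗comp₁ (inComponent-isConnectedComponent conΓ conΛ edΓ edΛ c₁) ,
  IsConnectedComponent-resp inComponent≗comp₂ (inComponent-isConnectedComponent conΓ conΛ edΓ edΛ c₂) ,
  IsRA-resp inComponent≗comp₁ (inComponent-isRA conΓ conΛ edΓ edΛ c₁) ,
  IsRA-resp inComponent≗comp₂ (inComponent-isRA conΓ conΛ edΓ edΛ c₂)
  where
  open BipartiteTensor Γ Λ bipΓ bipΛ
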